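{- For every positive rational number $x$, the snake graph $\mathcal{G}(x^{ -1})$ is the image of the snake graph $\mathcal{G}(x)$ under the map $\sigma:\mathbb{R}^2\to\mathbb{R}^2$, $(a,b)\mapsto(b,a)$.
   Context: Let $[a_0;\dots,a_{2\ell-1}]$ be the even-length continued fraction expansion of $x$ ($\ell\ge1$, $a_0\ge0$, $a_i\ge1$ for $i\ge1$) and $W(x)=\mathtt{1}^{a_0}\mathtt{0}^{a_1}\cdots\mathtt{1}^{a_{2\ell-2}}\mathtt{0}^{a_{2\ell-1}-1}$. With $\overline{\mathtt0}=\mathtt1,\overline{\mathtt1}=\mathtt0$, define $\theta(\varepsilon)=\varepsilon$ and $\theta(\alpha w)=\overline\alpha\theta(w)$ if $|w|$ even, $\alpha\theta(w)$ if $|w|$ odd. For a word $p$, $\vec p=(|p|_\mathtt0,|p|_\mathtt1)$; $S_g$ is the set of four edges of the unit square with lower-left corner $g\in\mathbb{Z}^2$. The snake graph $G(w)$ has vertex set $\{\vec p:p\text{ prefix of }w\}+\{(0,0),(1,0),(0,1),(1,1)\}$ and edge set $\bigcup_{p\text{ prefix of }w}S_{\vec p}$, embedded in $\mathbb{R}^2$. $\mathcal{G}(x)=G(\theta(W(x)))$. -}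

module Defs where

open import Data.Nat using (ℕ; zero; suc; _+_; _*_; _∸_; _≤_)
open import Data.Integer as ℤ using (ℤ; +_)
open import Data.Rational using (ℚ; ↥_; ↧_; Positive; 1/_)
open import Data.Rational.Properties using (pos⇒nonZero)
open import Data.List using (List; []; _∷_; _++_; replicate; length; inits)
open import Data.List.Relation.Unary.All using (All)
open import Data.List.Membership.Propositional using (_∈_)
open import Data.Product using (Σ; ∃; ∃-syntax; _×_; _,_)
open import Data.Sum using (_⊎_)
open import Function.Bundles using (_⇔_)
open import Relation.Binary.PropositionalEquality using (_≡_)

inv : (x : ℚ) → .{{_ : Positive x}} → ℚ
inv x = (1/ x) {{pos⇒nonZero x}}

-- cfFrac [a₀; a₁, …, aₙ] = (p , q) with [a₀; …, aₙ] = p / q,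
-- computed by  [a] = a/1,  [a; rest] = a + 1/[rest] = (a*p + q)/p .
cfFrac : List ℕ → ℕ × ℕ
cfFrac []       = (0 , 1)
cfFrac (a ∷ []) = (a , 1)
cfFrac (a ∷ rest@(_ ∷ _)) with cfFrac rest
... | (p , q) = (a * p + q , p)

_≈frac_ : ℚ → ℕ × ℕ → Set
x ≈frac (p , q) = ↥ x ℤ.* + q ≡ + p ℤ.* ↧ x

record IsEvenCF (x : ℚ) (as : List ℕ) : Set where
  field
    a₀        : ℕ
    tl        : List ℕ
    split     : as ≡ a₀ ∷ tl
    ℓ         : ℕ
    ℓ≥1       : 1 ≤ ℓ
    evenLen   : length as ≡ 2 * ℓ
    positive  : All (1 ≤_) tl
    value     : x ≈frac cfFrac as

data Bit : Set where
  𝟘 𝟙 : Bit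

flip : Bit → Bit
flip 𝟘 = 𝟙
flip 𝟙 = 𝟘

Wblocks : Bit → List ℕ → List Bit
Wblocks b []           = []
Wblocks b (a ∷ [])     = replicate (a ∸ 1) b
Wblocks b (a ∷ rest@(_ ∷ _)) = replicate a b ++ Wblocks (flip b) rest

-- W(x) = 1^{a₀} 0^{a₁} ⋯ 1^{a_{2ℓ-2}} 0^{a_{2ℓ-1}-1}  for as = [a₀;…;a_{2ℓ-1}].
W : List ℕ → List Bit
W as = Wblocks 𝟙 as

evenb : ℕ → Bit
evenb zero          = 𝟙   -- 𝟙 means "even"
evenb (suc zero)    = 𝟘
evenb (suc (suc n)) = evenb n

θ : List Bit → List Bit
θ []      = []
θ (α ∷ w) with evenb (length w)
... | 𝟙 = flip α ∷ θ w
... | 𝟘 = α ∷ θ w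

-- Snake graphs (lattice points in ℕ², which contain all vertices)

Pt : Set
Pt = ℕ × ℕ

count : Bit → List Bit → ℕ
count b []      = 0
count 𝟘 (𝟘 ∷ w) = suc (count 𝟘 w)
count 𝟘 (𝟙 ∷ w) = count 𝟘 w
count 𝟙 (𝟙 ∷ w) = suc (count 𝟙 w)
count 𝟙 (𝟘 ∷ w) = count 𝟙 w

vec : List Bit → Pt
vec p = (count 𝟘 p , count 𝟙 p)

corners : Pt → List Pt
corners (a , b) = (a , b) ∷ (suc a , b) ∷ (a , suc b) ∷ (suc a , suc b) ∷ []

S : Pt → List (Pt × Pt)
S (a , b) = ((a , b) , (suc a , b))
          ∷ ((a , suc b) , (suc a , suc b))
          ∷ ((a , b) , (a , suc b))
          ∷ ((suc a , b) , (suc a , suc b))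
          ∷ []

Vertex : List Bit → Pt → Set
Vertex w v = ∃[ p ] (p ∈ inits w × v ∈ corners (vec p))

-- edge set of G(w); edges are unordered pairs of points
Edge : List Bit → Pt → Pt → Set
Edge w u v = ∃[ p ] (p ∈ inits w × ((u , v) ∈ S (vec p) ⊎ (v , u) ∈ S (vec p)))

-- 𝒢(x) = G(θ(W(x))), given the expansion as of x
𝒢 : List ℕ → List Bit
𝒢 as = θ (W as)

σ : Pt → Pt
σ (a , b) = (b , a)

-- G(w') is the image of G(w) under σ (σ is an involution, so a point/edge
-- lies in σ(G(w)) iff its σ-image lies in G(w)).
IsσImage : (w' w : List Bit) → Set
IsσImage w' w =
  (∀ v → Vertex w' v ⇔ Vertex w (σ v)) ×
  (∀ u v → Edge w' u v ⇔ Edge w (σ u) (σ v))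

{-# OPTIONS --safe #-}

-- Read from right to left starting at 1, with 𝟙 acting as x ↦ x + 1 and 𝟘 as x ↦ x / (x + 1),
-- a binary word w has a Stern–Brocot value, and distinct words have distinct values.
-- The block structure of W(x) is exactly the recursion of the continued fraction, so the value
-- of W(x) is x. Exchanging 𝟘 and 𝟙 inverts the value, hence W(x⁻¹) is W(x) with letters exchanged.
-- θ commutes with the exchange, and exchanging letters swaps the two coordinates of every
-- prefix vector, so it moves the snake graph by σ.
module Submission where

open import Defs
open import Data.Nat using (ℕ)
open import Data.List using (List)
open import Data.Rational using (ℚ; Positive)

open import Data.Empty using (⊥-elim)
open import Data.Integer as ℤ using (+[1+_]; -[1+_])
import Data.Integer.Properties as ℤP
open import Data.List using ([]; _∷_; _++_; replicate; length; inits; map)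
open import Data.List.Membership.Propositional using (_∈_)
open import Data.List.Membership.Propositional.Properties using (∈-map⁺)
open import Data.List.Properties using (map-replicate; map-++; map-∘; length-map)
open import Data.List.Relation.Unary.All using (All; _∷_)
open import Data.List.Relation.Unary.Any using (here; there)
open import Data.Nat using (zero; suc; _+_; _*_; _<_; _≤_; z<s; >-nonZero)
open import Data.Nat.Properties
open import Data.Nat.Coprimality using (Coprime) renaming (sym to Coprime-sym)
open import Algebra.Properties.CommutativeSemigroup *-commutativeSemigroup using (xy∙z≈xz∙y)
open import Data.Product using (_×_; _,_; proj₁; proj₂; swap)
open import Data.Rational using (mkℚ)
open import Data.Sum using (_⊎_; inj₁; inj₂)
open import Function.Base using (_∘_)
open import Function.Bundles using (mk⇔)
open import Relation.Binary.PropositionalEquality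

infix 4 _≍_

data _≍_ : ℕ × ℕ → ℕ × ℕ → Set where
  cross : ∀ {p q p′ q′} → p * q′ ≡ p′ * q → (p , q) ≍ (p′ , q′)

≍-sym : ∀ {a b} → a ≍ b → b ≍ a
≍-sym (cross e) = cross (sym e)

≍-swap : ∀ {a b} → a ≍ b → swap a ≍ swap b
≍-swap (cross {p} {q} {p′} {q′} e) = cross (trans (*-comm q p′) (trans (sym e) (*-comm p q′)))

≍-trans : ∀ {a b c} → 0 < proj₂ b → a ≍ b → b ≍ c → a ≍ c
≍-trans q′>0 (cross {p} {q} {p′} {q′} e₁) (cross {p′ = p″} {q′ = q″} e₂) =
  cross (*-cancelʳ-≡ (p * q″) (p″ * q) q′ {{>-nonZero q′>0}} (begin
    p * q″ * q′   ≡⟨ xy∙z≈xz∙y p q″ q′ ⟩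
    p * q′ * q″   ≡⟨ cong (_* q″) e₁ ⟩
    p′ * q * q″   ≡⟨ xy∙z≈xz∙y p′ q q″ ⟩
    p′ * q″ * q   ≡⟨ cong (_* q) e₂ ⟩
    p″ * q′ * q   ≡⟨ xy∙z≈xz∙y p″ q′ q ⟩
    p″ * q * q′   ∎))
  where open ≡-Reasoning

ProperFraction : ℕ × ℕ → Set
ProperFraction (p , q) = p < q

≍-preserves-ProperFraction : ∀ {a b} → 0 < proj₂ b → a ≍ b → ProperFraction a → ProperFraction b
≍-preserves-ProperFraction q′>0 (cross {p} {q} {p′} {q′} e) p<q = *-cancelʳ-< q p′ q′ (begin-strict
  p′ * q   ≡⟨ sym e ⟩
  p * q′   <⟨ *-monoˡ-< q′ {{>-nonZero q′>0}} p<q ⟩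
  q * q′   ≡⟨ *-comm q q′ ⟩
  q′ * q   ∎)
  where open ≤-Reasoning

R L : ℕ × ℕ → ℕ × ℕ
R (p , q) = (p + q , q)
L (p , q) = (p , q + p)

≍-cancel-R : ∀ a b → R a ≍ R b → a ≍ b
≍-cancel-R (p , q) (p′ , q′) (cross e) = cross (+-cancelʳ-≡ (q * q′) (p * q′) (p′ * q) (begin
  p * q′ + q * q′   ≡⟨ *-distribʳ-+ q′ p q ⟨
  (p + q) * q′      ≡⟨ e ⟩
  (p′ + q′) * q     ≡⟨ *-distribʳ-+ q p′ q′ ⟩
  p′ * q + q′ * q   ≡⟨ cong (p′ * q +_) (*-comm q′ q) ⟩
  p′ * q + q * q′   ∎))
  where open ≡-Reasoning

-- L is R conjugated by swap, definitionally.
≍-cancel-L : ∀ a b → L a ≍ L b → a ≍ b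
≍-cancel-L a b e = ≍-swap (≍-cancel-R (swap a) (swap b) (≍-swap e))

sternBrocot : List Bit → ℕ × ℕ
sternBrocot []      = (1 , 1)
sternBrocot (𝟙 ∷ w) = R (sternBrocot w)
sternBrocot (𝟘 ∷ w) = L (sternBrocot w)

sternBrocot-positive : ∀ w → 0 < proj₁ (sternBrocot w) × 0 < proj₂ (sternBrocot w)
sternBrocot-positive []      = z<s , z<s
sternBrocot-positive (𝟙 ∷ w) with sternBrocot-positive w
... | p>0 , q>0 = <-≤-trans p>0 (m≤m+n _ _) , q>0
sternBrocot-positive (𝟘 ∷ w) with sternBrocot-positive w
... | p>0 , q>0 = p>0 , <-≤-trans p>0 (m≤n+m _ _)

sternBrocot-map-flip : ∀ w → sternBrocot (map flip w) ≡ swap (sternBrocot w)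
sternBrocot-map-flip []      = refl
sternBrocot-map-flip (𝟘 ∷ w) = cong R (sternBrocot-map-flip w)
sternBrocot-map-flip (𝟙 ∷ w) = cong L (sternBrocot-map-flip w)

sternBrocot-𝟘-proper : ∀ w → ProperFraction (sternBrocot (𝟘 ∷ w))
sternBrocot-𝟘-proper w = m<n+m _ (proj₂ (sternBrocot-positive w))

sternBrocot-𝟙-improper : ∀ w → ProperFraction (swap (sternBrocot (𝟙 ∷ w)))
sternBrocot-𝟙-improper w = m<n+m _ (proj₁ (sternBrocot-positive w))

sternBrocot-injective : ∀ w w′ → sternBrocot w ≍ sternBrocot w′ → w ≡ w′
sternBrocot-injective []      []       e = refl
sternBrocot-injective (𝟘 ∷ w) (𝟘 ∷ w′) e = cong (𝟘 ∷_) (sternBrocot-injective w w′ (≍-cancel-L _ _ e))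
sternBrocot-injective (𝟙 ∷ w) (𝟙 ∷ w′) e = cong (𝟙 ∷_) (sternBrocot-injective w w′ (≍-cancel-R _ _ e))
sternBrocot-injective []      (𝟘 ∷ w′) e =
  ⊥-elim (<-irrefl refl (≍-preserves-ProperFraction z<s (≍-sym e) (sternBrocot-𝟘-proper w′)))
sternBrocot-injective (𝟘 ∷ w) []       e =
  ⊥-elim (<-irrefl refl (≍-preserves-ProperFraction z<s e (sternBrocot-𝟘-proper w)))
sternBrocot-injective []      (𝟙 ∷ w′) e =
  ⊥-elim (<-irrefl refl (≍-preserves-ProperFraction z<s (≍-swap (≍-sym e)) (sternBrocot-𝟙-improper w′)))
sternBrocot-injective (𝟙 ∷ w) []       e =
  ⊥-elim (<-irrefl refl (≍-preserves-ProperFraction z<s (≍-swap e) (sternBrocot-𝟙-improper w)))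
sternBrocot-injective (𝟘 ∷ w) (𝟙 ∷ w′) e =
  ⊥-elim (<-asym (sternBrocot-𝟙-improper w′)
    (≍-preserves-ProperFraction (proj₂ (sternBrocot-positive w′)) e (sternBrocot-𝟘-proper w)))
sternBrocot-injective (𝟙 ∷ w) (𝟘 ∷ w′) e =
  ⊥-elim (<-asym (sternBrocot-𝟙-improper w)
    (≍-preserves-ProperFraction (proj₂ (sternBrocot-positive w)) (≍-sym e) (sternBrocot-𝟘-proper w′)))

Wblocks-flip : ∀ b as → Wblocks (flip b) as ≡ map flip (Wblocks b as)
Wblocks-flip b []          = refl
Wblocks-flip b (a ∷ [])    = sym (map-replicate flip _ b)
Wblocks-flip b (a ∷ c ∷ r) = begin
  replicate a (flip b) ++ Wblocks (flip (flip b)) (c ∷ r)         ≡⟨ cong (_ ++_) (Wblocks-flip (flip b) (c ∷ r)) ⟩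
  replicate a (flip b) ++ map flip (Wblocks (flip b) (c ∷ r))     ≡⟨ cong (_++ _) (map-replicate flip a b) ⟨
  map flip (replicate a b) ++ map flip (Wblocks (flip b) (c ∷ r)) ≡⟨ map-++ flip (replicate a b) _ ⟨
  map flip (replicate a b ++ Wblocks (flip b) (c ∷ r))            ∎
  where open ≡-Reasoning

R^ : ℕ → ℕ × ℕ → ℕ × ℕ
R^ a (p , q) = (a * q + p , q)

sternBrocot-𝟙ⁿ++ : ∀ a w → sternBrocot (replicate a 𝟙 ++ w) ≡ R^ a (sternBrocot w)
sternBrocot-𝟙ⁿ++ zero    w = refl
sternBrocot-𝟙ⁿ++ (suc a) w rewrite sternBrocot-𝟙ⁿ++ a w =
  cong (_, q) (trans (+-comm (a * q + p) q) (sym (+-assoc q (a * q) p)))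
  where
  p = proj₁ (sternBrocot w)
  q = proj₂ (sternBrocot w)

sternBrocot-𝟙ⁿ : ∀ a → sternBrocot (replicate a 𝟙) ≡ (suc a , 1)
sternBrocot-𝟙ⁿ zero    = refl
sternBrocot-𝟙ⁿ (suc a) = trans (cong R (sternBrocot-𝟙ⁿ a)) (cong (_, 1) (+-comm (suc a) 1))

cfFrac-cons : ∀ a b r → cfFrac (a ∷ b ∷ r) ≡ R^ a (swap (cfFrac (b ∷ r)))
cfFrac-cons a b r with cfFrac (b ∷ r)
... | (p , q) = refl

sternBrocot-W-cons : ∀ a b r → sternBrocot (W (b ∷ r)) ≡ cfFrac (b ∷ r) →
                     sternBrocot (W (a ∷ b ∷ r)) ≡ cfFrac (a ∷ b ∷ r)
sternBrocot-W-cons a b r hyp = begin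
  sternBrocot (replicate a 𝟙 ++ Wblocks 𝟘 (b ∷ r))  ≡⟨ sternBrocot-𝟙ⁿ++ a _ ⟩
  R^ a (sternBrocot (Wblocks 𝟘 (b ∷ r)))            ≡⟨ cong (R^ a ∘ sternBrocot) (Wblocks-flip 𝟙 (b ∷ r)) ⟩
  R^ a (sternBrocot (map flip (W (b ∷ r))))         ≡⟨ cong (R^ a) (sternBrocot-map-flip (W (b ∷ r))) ⟩
  R^ a (swap (sternBrocot (W (b ∷ r))))             ≡⟨ cong (R^ a ∘ swap) hyp ⟩
  R^ a (swap (cfFrac (b ∷ r)))                      ≡⟨ cfFrac-cons a b r ⟨
  cfFrac (a ∷ b ∷ r)                                ∎
  where open ≡-Reasoning

sternBrocot-W-positive : ∀ a r → All (1 ≤_) (a ∷ r) → sternBrocot (W (a ∷ r)) ≡ cfFrac (a ∷ r)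
sternBrocot-W-positive (suc a) []      _        = sternBrocot-𝟙ⁿ a
sternBrocot-W-positive a       (b ∷ r) (_ ∷ ps) = sternBrocot-W-cons a b r (sternBrocot-W-positive b r ps)

-- An expansion of even length has at least two terms; since a₀ may be 0, only the tail is covered
-- by sternBrocot-W-positive.
IsEvenCF⇒≈sternBrocot-W : ∀ {x} as → IsEvenCF x as → x ≈frac sternBrocot (W as)
IsEvenCF⇒≈sternBrocot-W _ record { tl = [] ; split = refl ; ℓ = ℓ ; evenLen = 1≡2ℓ } =
  ⊥-elim (1+n≢n (m*n≡1⇒m≡1 2 ℓ (sym 1≡2ℓ)))
IsEvenCF⇒≈sternBrocot-W {x} _ record { a₀ = a ; tl = b ∷ r ; split = refl ; positive = ps ; value = v } =
  subst (x ≈frac_) (sym (sternBrocot-W-cons a b r (sternBrocot-W-positive b r ps))) v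

≈frac⇒≍ : ∀ n d .(c : Coprime n (suc d)) a → mkℚ (ℤ.+ n) d c ≈frac a → a ≍ (n , suc d)
≈frac⇒≍ n d c (p , q) e =
  cross (sym (ℤP.+-injective (trans (ℤP.pos-* n q) (trans e (sym (ℤP.pos-* p (suc d)))))))

≈frac-inv : ∀ x .{{_ : Positive x}} a b → x ≈frac a → inv x ≈frac b → b ≍ swap a
≈frac-inv (mkℚ +[1+ n ] d c) a b x≈a x⁻¹≈b =
  ≍-trans z<s (≈frac⇒≍ (suc d) n (Coprime-sym c) b x⁻¹≈b) (≍-sym (≍-swap (≈frac⇒≍ (suc n) d c a x≈a)))
≈frac-inv (mkℚ (ℤ.+ zero) d c) {{()}} a b x≈a x⁻¹≈b
≈frac-inv (mkℚ -[1+ n ]    d c) {{()}} a b x≈a x⁻¹≈b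

θ-map-flip : ∀ w → θ (map flip w) ≡ map flip (θ w)
θ-map-flip []      = refl
θ-map-flip (α ∷ w) rewrite length-map flip w with evenb (length w)
... | 𝟙 = cong (flip (flip α) ∷_) (θ-map-flip w)
... | 𝟘 = cong (flip α ∷_) (θ-map-flip w)

map-flip-involutive : ∀ w → map flip (map flip w) ≡ w
map-flip-involutive []      = refl
map-flip-involutive (𝟘 ∷ w) = cong (𝟘 ∷_) (map-flip-involutive w)
map-flip-involutive (𝟙 ∷ w) = cong (𝟙 ∷_) (map-flip-involutive w)

inits-map : ∀ {A B : Set} (f : A → B) xs → inits (map f xs) ≡ map (map f) (inits xs)
inits-map f []       = refl
inits-map f (x ∷ xs) = cong ([] ∷_) (begin
  map (f x ∷_) (inits (map f xs))        ≡⟨ cong (map (f x ∷_)) (inits-map f xs) ⟩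
  map (f x ∷_) (map (map f) (inits xs))  ≡⟨ map-∘ (inits xs) ⟨
  map (map f ∘ (x ∷_)) (inits xs)        ≡⟨ map-∘ (inits xs) ⟩
  map (map f) (map (x ∷_) (inits xs))    ∎)
  where open ≡-Reasoning

count-map-flip : ∀ b p → count b (map flip p) ≡ count (flip b) p
count-map-flip b []       = refl
count-map-flip 𝟘 (𝟘 ∷ p) = count-map-flip 𝟘 p
count-map-flip 𝟘 (𝟙 ∷ p) = cong suc (count-map-flip 𝟘 p)
count-map-flip 𝟙 (𝟘 ∷ p) = cong suc (count-map-flip 𝟙 p)
count-map-flip 𝟙 (𝟙 ∷ p) = count-map-flip 𝟙 p

vec-map-flip : ∀ p → vec (map flip p) ≡ σ (vec p)
vec-map-flip p = cong₂ _,_ (count-map-flip 𝟘 p) (count-map-flip 𝟙 p)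

corners-σ : ∀ {g u} → u ∈ corners g → σ u ∈ corners (σ g)
corners-σ (here refl)                         = here refl
corners-σ (there (here refl))                 = there (there (here refl))
corners-σ (there (there (here refl)))         = there (here refl)
corners-σ (there (there (there (here refl)))) = there (there (there (here refl)))

S-σ : ∀ {g u v} → (u , v) ∈ S g → (σ u , σ v) ∈ S (σ g)
S-σ (here refl)                         = there (there (here refl))
S-σ (there (here refl))                 = there (there (there (here refl)))
S-σ (there (there (here refl)))         = here refl
S-σ (there (there (there (here refl)))) = there (here refl)

inits-map-flip⁺ : ∀ {p w} → p ∈ inits w → map flip p ∈ inits (map flip w)
inits-map-flip⁺ {p} {w} p∈ = subst (map flip p ∈_) (sym (inits-map flip w)) (∈-map⁺ (map flip) p∈)

Vertex-map-flip : ∀ {w v} → Vertex w v → Vertex (map flip w) (σ v)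
Vertex-map-flip (p , p∈ , v∈) =
  map flip p , inits-map-flip⁺ p∈ , subst (λ g → _ ∈ corners g) (sym (vec-map-flip p)) (corners-σ v∈)

Edge-map-flip : ∀ {w u v} → Edge w u v → Edge (map flip w) (σ u) (σ v)
Edge-map-flip (p , p∈ , uv∈) =
  map flip p , inits-map-flip⁺ p∈ , subst (λ g → _ ∈ S g ⊎ _ ∈ S g) (sym (vec-map-flip p)) (S-σ-sym uv∈)
  where
  S-σ-sym : ∀ {g u v} → (u , v) ∈ S g ⊎ (v , u) ∈ S g → (σ u , σ v) ∈ S (σ g) ⊎ (σ v , σ u) ∈ S (σ g)
  S-σ-sym (inj₁ uv∈) = inj₁ (S-σ uv∈)
  S-σ-sym (inj₂ vu∈) = inj₂ (S-σ vu∈)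

-- The backward directions are the forward ones applied again: σ (σ v) reduces to v by η for pairs.
map-flip-isσImage : ∀ w → IsσImage (map flip w) w
map-flip-isσImage w =
  (λ v → mk⇔ (unflip (λ w′ → Vertex w′ (σ v)) ∘ Vertex-map-flip) Vertex-map-flip) ,
  (λ u v → mk⇔ (unflip (λ w′ → Edge w′ (σ u) (σ v)) ∘ Edge-map-flip) Edge-map-flip)
  where
  unflip : (P : List Bit → Set) → P (map flip (map flip w)) → P w
  unflip P = subst P (map-flip-involutive w)

lemma7p5 : (x : ℚ) → .{{_ : Positive x}} → (as bs : List ℕ) →
    IsEvenCF x as → IsEvenCF (inv x) bs → IsσImage (𝒢 bs) (𝒢 as)
lemma7p5 x as bs x≈as x⁻¹≈bs = subst (λ w → IsσImage w (𝒢 as)) (sym 𝒢-inv) (map-flip-isσImage (𝒢 as))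
  where
  W-inv : W bs ≡ map flip (W as)
  W-inv = sternBrocot-injective (W bs) (map flip (W as))
    (subst (sternBrocot (W bs) ≍_) (sym (sternBrocot-map-flip (W as)))
      (≈frac-inv x _ _ (IsEvenCF⇒≈sternBrocot-W as x≈as) (IsEvenCF⇒≈sternBrocot-W bs x⁻¹≈bs)))

  𝒢-inv : 𝒢 bs ≡ map flip (𝒢 as)
  𝒢-inv = trans (cong θ W-inv) (θ-map-flip (W as))
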